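{- Let $h:\mathbb{Z}_{\ge0}\to\mathbb{Z}_{\ge0}$ be a monotonically increasing function with the NS-property. Then for every positive integer $z$, $h(z)\le 2^{\lfloor \log_2 z\rfloor}-1$.
   Context: A function $h:\mathbb{Z}_{\ge0}\to\mathbb{Z}_{\ge0}$ is monotonically increasing if $h(u)\le h(v)$ whenever $u\le v$. Such an $h$ has the NS-property if both of the following hold: - $h(0)=0$; - for all $z,z'\in\mathbb{Z}_{\ge0}$ and every positive integer $i$, $\lfloor z/2^i\rfloor=\lfloor z'/2^i\rfloor$ implies $\lfloor h(z)/2^{i-1}\rfloor=\lfloor h(z')/2^{i-1}\rfloor$. -}

module Defs where

open import Data.Nat using (ℕ; zero; suc; _^_; _≤_; _≡ᵇ_)
open import Data.Nat.DivMod using (_/_)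
open import Data.Nat.Properties using (m^n≢0)
open import Data.Product using (_×_)
open import Relation.Binary.PropositionalEquality using (_≡_)

_div2^_ : ℕ → ℕ → ℕ
z div2^ i = _/_ z (2 ^ i) {{m^n≢0 2 i}}

Monotone : (ℕ → ℕ) → Set
Monotone h = ∀ u v → u ≤ v → h u ≤ h v

-- NS-property: h 0 = 0, and for every positive integer i (written suc i),
-- ⌊z/2^i⌋ = ⌊z'/2^i⌋ implies ⌊h z/2^(i-1)⌋ = ⌊h z'/2^(i-1)⌋.
NSProperty : (ℕ → ℕ) → Set
NSProperty h =
  (h 0 ≡ 0) ×
  (∀ (z z' i : ℕ) → z div2^ suc i ≡ z' div2^ suc i →
                    h z div2^ i ≡ h z' div2^ i)

-- Put k = ⌊log₂ z⌋, so that z < 2^(k+1). Then ⌊z/2^(k+1)⌋ = 0 = ⌊0/2^(k+1)⌋,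
-- and the NS-property gives ⌊h z/2^k⌋ = ⌊h 0/2^k⌋ = 0, i.e. h z < 2^k.
module Submission where

open import Defs
open import Data.Nat using (ℕ; suc; _^_; _∸_; _≤_)
open import Data.Nat.Logarithm using (⌊log₂_⌋)
open import Data.Nat.Base using (zero; _+_; _*_; _<_; z≤n; s≤s; pred; ⌊_/2⌋)
open import Data.Nat.Properties
open import Data.Nat.DivMod using (m<n⇒m/n≡0; m/n≡0⇒m<n; 0/n≡0)
open import Data.Nat.Logarithm.Core using (⌊log2⌋)
open import Data.Nat.Induction using (<-wellFounded)
open import Induction.WellFounded using (Acc; acc)
open import Data.Product using (_,_)
open import Relation.Binary.PropositionalEquality using (_≡_; sym; trans; cong)

n≤1+2*⌊n/2⌋ : ∀ n → n ≤ 1 + 2 * ⌊ n /2⌋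
n≤1+2*⌊n/2⌋ zero = z≤n
n≤1+2*⌊n/2⌋ (suc zero) = s≤s z≤n
n≤1+2*⌊n/2⌋ (suc (suc n)) = begin
  2 + n                  ≤⟨ +-monoʳ-≤ 2 (n≤1+2*⌊n/2⌋ n) ⟩
  1 + (2 + 2 * ⌊ n /2⌋)  ≡⟨ cong suc (*-suc 2 ⌊ n /2⌋) ⟨
  1 + 2 * (1 + ⌊ n /2⌋)  ∎
  where open ≤-Reasoning

n<2^[1+⌊log2⌋n] : ∀ n (rec : Acc _<_ n) → n < 2 ^ suc (⌊log2⌋ n rec)
n<2^[1+⌊log2⌋n] zero _ = s≤s z≤n
n<2^[1+⌊log2⌋n] (suc zero) _ = s≤s (s≤s z≤n)
n<2^[1+⌊log2⌋n] (suc (suc n)) (acc rs) = begin-strict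
  2 + n                  ≤⟨ +-monoʳ-≤ 2 (n≤1+2*⌊n/2⌋ n) ⟩
  3 + 2 * ⌊ n /2⌋        <⟨ n<1+n _ ⟩
  4 + 2 * ⌊ n /2⌋        ≡⟨ *-distribˡ-+ 2 2 ⌊ n /2⌋ ⟨
  2 * (2 + ⌊ n /2⌋)      ≤⟨ *-monoʳ-≤ 2 (n<2^[1+⌊log2⌋n] (suc ⌊ n /2⌋) _) ⟩
  2 * 2 ^ suc (⌊log2⌋ (suc ⌊ n /2⌋) _) ∎
  where open ≤-Reasoning

n<2^[1+⌊log₂n⌋] : ∀ n → n < 2 ^ suc ⌊log₂ n ⌋
n<2^[1+⌊log₂n⌋] n = n<2^[1+⌊log2⌋n] n (<-wellFounded n)

NSProperty⇒h<2^⌊log₂⌋ : (h : ℕ → ℕ) → NSProperty h → ∀ z → h z < 2 ^ ⌊log₂ z ⌋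
NSProperty⇒h<2^⌊log₂⌋ h (h0≡0 , ns) z = m/n≡0⇒m<n {{m^n≢0 2 k}} h[z]/2^k≡0
  where
  k = ⌊log₂ z ⌋
  0/2^i≡0 : ∀ i → 0 div2^ i ≡ 0
  0/2^i≡0 i = 0/n≡0 (2 ^ i) {{m^n≢0 2 i}}
  z/2^[1+k]≡0/2^[1+k] : z div2^ suc k ≡ 0 div2^ suc k
  z/2^[1+k]≡0/2^[1+k] = trans (m<n⇒m/n≡0 {{m^n≢0 2 (suc k)}} (n<2^[1+⌊log₂n⌋] z))
                              (sym (0/2^i≡0 (suc k)))
  h[z]/2^k≡0 : h z div2^ k ≡ 0
  h[z]/2^k≡0 = trans (ns z 0 k z/2^[1+k]≡0/2^[1+k]) (trans (cong (_div2^ k) h0≡0) (0/2^i≡0 k))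

lemma1 : (h : ℕ → ℕ) → Monotone h → NSProperty h →
         ∀ (z : ℕ) → h (suc z) ≤ 2 ^ ⌊log₂ suc z ⌋ ∸ 1
lemma1 h _ ns z = begin
  h (suc z)                    ≤⟨ <⇒≤pred (NSProperty⇒h<2^⌊log₂⌋ h ns (suc z)) ⟩
  pred (2 ^ ⌊log₂ suc z ⌋)     ≡⟨ pred[m∸n]≡m∸[1+n] (2 ^ ⌊log₂ suc z ⌋) 0 ⟩
  2 ^ ⌊log₂ suc z ⌋ ∸ 1        ∎
  where open ≤-Reasoning
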